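{- In System $\mathsf{F}_{<:}^{K\top}$, for any type $\Theta\vdash T$, the type $\Theta\vdash\Theta^*(T)$ is not a type variable, satisfies $\Theta\vdash T<:\Theta^*(T)$, and is minimal with these properties: for every type $T'$ that is not a type variable, if $\Theta\vdash T<:T'$ then $\Theta\vdash\Theta^*(T)<:T'$.
   Context: System $\mathsf{F}_{<:}^{K\top}$ types: $T ::= \top \mid X \mid T\to T \mid \forall^{K}(X<:T).T \mid \forall^{\top}(X<:T).T$ (up to $\alpha$-conversion); contexts are finite sequences of $X<:T$ and $x:T$ with the usual well-formedness judgment $\Theta\vdash T$. Subtyping $\Theta\vdash S<:T$ is generated by: (Var) $\Theta,X<:T,\Theta'\vdash X<:T$; (Top) $\Theta\vdash T<:\top$; (Refl); (Trans); ($\to$) from $\Theta\vdash S'<:S$, $\Theta\vdash T<:T'$ infer $\Theta\vdash S\to T<:S'\to T'$; ($\forall$-Fun) from $\Theta,X<:S\vdash T<:T'$ infer $\Theta\vdash\forall^K(X<:S).T<:\forall^K(X<:S).T'$; ($\forall$-Loc) from $\Theta\vdash T_0<:S_0$, $\Theta,X<:S_0\vdash S_1<:T_1$ infer $\Theta\vdash\forall^K(X<:S_0).S_1<:\forall^\top(X<:T_0).T_1$; ($\forall$-Top) from $\Theta\vdash T_0<:S_0$, $\Theta,X<:\top\vdash S_1<:T_1$ infer $\Theta\vdash\forall^\top(X<:S_0).S_1<:\forall^\top(X<:T_0).T_1$. Define $\Theta^*(T)=\Theta^*(S)$ if $T$ is a type variable $X$ and $\Theta=\Theta',X<:S,\Theta''$,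 and $\Theta^*(T)=T$ otherwise. -}

module Defs where

open import Data.Nat using (ℕ; zero; suc)
open import Data.Fin using (Fin; zero; suc)
open import Data.Product using (Σ)
open import Relation.Binary.PropositionalEquality using (_≡_)

-- Types of System F<:^{K⊤}, intrinsically scoped with de Bruijn indices
-- (so types are identified up to α-conversion, and  Θ ⊢ T  for Θ : Ctx n
-- is exactly  T : Ty n).
data Ty (n : ℕ) : Set where
  top  : Ty n
  var  : Fin n → Ty n
  _⇒_  : Ty n → Ty n → Ty n
  allK : Ty n → Ty (suc n) → Ty n   -- ∀^K (X <: S). T
  allT : Ty n → Ty (suc n) → Ty n   -- ∀^⊤ (X <: S). T

infixr 7 _⇒_

ext : ∀ {n m} → (Fin n → Fin m) → Fin (suc n) → Fin (suc m)
ext ρ zero    = zero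
ext ρ (suc i) = suc (ρ i)

rename : ∀ {n m} → (Fin n → Fin m) → Ty n → Ty m
rename ρ top        = top
rename ρ (var X)    = var (ρ X)
rename ρ (S ⇒ T)    = rename ρ S ⇒ rename ρ T
rename ρ (allK S T) = allK (rename ρ S) (rename (ext ρ) T)
rename ρ (allT S T) = allT (rename ρ S) (rename (ext ρ) T)

weaken : ∀ {n} → Ty n → Ty (suc n)
weaken = rename suc

-- Contexts: sequences of type bindings X <: T (which bind a new type
-- variable) and term bindings x : T (which bind no type variable).
-- Ctx n = contexts binding n type variables; every bound is well-formed
-- in the preceding context by construction.
data Ctx : ℕ → Set where
  ∅     : Ctx zero
  _,<:_ : ∀ {n} → Ctx n → Ty n → Ctx (suc n)
  _,∶_  : ∀ {n} → Ctx n → Ty n → Ctx n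

infixl 5 _,<:_ _,∶_

bound : ∀ {n} → Ctx n → Fin n → Ty n
bound (Θ ,<: S) zero    = weaken S
bound (Θ ,<: S) (suc X) = weaken (bound Θ X)
bound (Θ ,∶ _)  X       = bound Θ X

infix 3 _⊢_<:_
data _⊢_<:_ : ∀ {n} → Ctx n → Ty n → Ty n → Set where
  s-var   : ∀ {n} {Θ : Ctx n} {X} → Θ ⊢ var X <: bound Θ X
  s-top   : ∀ {n} {Θ : Ctx n} {T} → Θ ⊢ T <: top
  s-refl  : ∀ {n} {Θ : Ctx n} {T} → Θ ⊢ T <: T
  s-trans : ∀ {n} {Θ : Ctx n} {S T U} → Θ ⊢ S <: T → Θ ⊢ T <: U → Θ ⊢ S <: U
  s-arr   : ∀ {n} {Θ : Ctx n} {S S' T T'} →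
            Θ ⊢ S' <: S → Θ ⊢ T <: T' → Θ ⊢ S ⇒ T <: S' ⇒ T'
  s-allFun : ∀ {n} {Θ : Ctx n} {S T T'} →
            Θ ,<: S ⊢ T <: T' → Θ ⊢ allK S T <: allK S T'
  s-allLoc : ∀ {n} {Θ : Ctx n} {S₀ S₁ T₀ T₁} →
            Θ ⊢ T₀ <: S₀ → Θ ,<: S₀ ⊢ S₁ <: T₁ → Θ ⊢ allK S₀ S₁ <: allT T₀ T₁
  s-allTop : ∀ {n} {Θ : Ctx n} {S₀ S₁ T₀ T₁} →
            Θ ⊢ T₀ <: S₀ → Θ ,<: top ⊢ S₁ <: T₁ → Θ ⊢ allT S₀ S₁ <: allT T₀ T₁

mutual
  star : ∀ {n} → Ctx n → Ty n → Ty n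
  star Θ (var X) = starVar Θ X
  star Θ T       = T

  starVar : ∀ {n} → Ctx n → Fin n → Ty n
  starVar (Θ ,<: S) zero    = weaken (star Θ S)
  starVar (Θ ,<: S) (suc X) = weaken (starVar Θ X)
  starVar (Θ ,∶ _)  X       = starVar Θ X

IsVar : ∀ {n} → Ty n → Set
IsVar {n} T = Σ (Fin n) (λ X → T ≡ var X)

-- A variable's bound, when it is itself a variable, lies further out in the
-- context, so following bounds terminates; each step is an instance of (Var),
-- whence T <: Θ*(T) by transitivity.  For minimality, Θ* is monotone: every
-- rule other than (Var) relates two non-variables, on which Θ* is the
-- identity, and (Var) relates X and its bound, which Θ* identifies.
module Submission where

open import Defs
open import Data.Product using (_×_; _,_; Σ-syntax)
open import Data.Fin using (Fin; zero; suc; _<_; _>_)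
open import Data.Fin.Induction using (>-wellFounded)
open import Data.Nat using (z≤n; s≤s)
open import Data.Empty using (⊥-elim)
open import Induction.WellFounded using (Acc; acc)
open import Relation.Nullary using (¬_)
open import Relation.Binary.PropositionalEquality using (_≡_; refl; sym; trans; cong; subst)

weaken≡var⇒ : ∀ {n} (T : Ty n) Y → weaken T ≡ var Y →
  Σ[ Y' ∈ Fin n ] T ≡ var Y' × Y ≡ suc Y'
weaken≡var⇒ (var Y') .(suc Y') refl = Y' , refl , refl

weaken-¬IsVar : ∀ {n} (T : Ty n) → ¬ IsVar T → ¬ IsVar (weaken T)
weaken-¬IsVar T ¬var (Y , eq) with weaken≡var⇒ T Y eq
... | Y' , T≡Y' , _ = ¬var (Y' , T≡Y')

star-¬IsVar : ∀ {n} (Θ : Ctx n) T → ¬ IsVar T → star Θ T ≡ T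
star-¬IsVar Θ (var X) ¬var = ⊥-elim (¬var (X , refl))
star-¬IsVar Θ top        _ = refl
star-¬IsVar Θ (_ ⇒ _)    _ = refl
star-¬IsVar Θ (allK _ _) _ = refl
star-¬IsVar Θ (allT _ _) _ = refl

mutual
  ¬IsVar-star : ∀ {n} (Θ : Ctx n) T → ¬ IsVar (star Θ T)
  ¬IsVar-star Θ (var X)    = ¬IsVar-starVar Θ X
  ¬IsVar-star Θ top        (_ , ())
  ¬IsVar-star Θ (_ ⇒ _)    (_ , ())
  ¬IsVar-star Θ (allK _ _) (_ , ())
  ¬IsVar-star Θ (allT _ _) (_ , ())

  ¬IsVar-starVar : ∀ {n} (Θ : Ctx n) X → ¬ IsVar (starVar Θ X)
  ¬IsVar-starVar (Θ ,<: S) zero    = weaken-¬IsVar (star Θ S) (¬IsVar-star Θ S)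
  ¬IsVar-starVar (Θ ,<: S) (suc X) = weaken-¬IsVar (starVar Θ X) (¬IsVar-starVar Θ X)
  ¬IsVar-starVar (Θ ,∶ _)  X       = ¬IsVar-starVar Θ X

star-weaken : ∀ {n} (Θ : Ctx n) S T → star (Θ ,<: S) (weaken T) ≡ weaken (star Θ T)
star-weaken Θ S top        = refl
star-weaken Θ S (var X)    = refl
star-weaken Θ S (_ ⇒ _)    = refl
star-weaken Θ S (allK _ _) = refl
star-weaken Θ S (allT _ _) = refl

star-,∶ : ∀ {n} (Θ : Ctx n) U T → star (Θ ,∶ U) T ≡ star Θ T
star-,∶ Θ U top        = refl
star-,∶ Θ U (var X)    = refl
star-,∶ Θ U (_ ⇒ _)    = refl
star-,∶ Θ U (allK _ _) = refl
star-,∶ Θ U (allT _ _) = refl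

starVar≡star-bound : ∀ {n} (Θ : Ctx n) X → starVar Θ X ≡ star Θ (bound Θ X)
starVar≡star-bound (Θ ,<: S) zero    = sym (star-weaken Θ S S)
starVar≡star-bound (Θ ,<: S) (suc X) =
  trans (cong weaken (starVar≡star-bound Θ X)) (sym (star-weaken Θ S (bound Θ X)))
starVar≡star-bound (Θ ,∶ U)  X       =
  trans (starVar≡star-bound Θ X) (sym (star-,∶ Θ U (bound Θ X)))

bound≡var⇒< : ∀ {n} (Θ : Ctx n) X Y → bound Θ X ≡ var Y → X < Y
bound≡var⇒< (Θ ,<: S) zero Y eq with weaken≡var⇒ S Y eq
... | _ , _ , refl = s≤s z≤n
bound≡var⇒< (Θ ,<: S) (suc X) Y eq with weaken≡var⇒ (bound Θ X) Y eq
... | Y' , bound≡Y' , refl = s≤s (bound≡var⇒< Θ X Y' bound≡Y')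
bound≡var⇒< (Θ ,∶ U) X Y eq = bound≡var⇒< Θ X Y eq

var<:starVar : ∀ {n} (Θ : Ctx n) X → Acc _>_ X → Θ ⊢ var X <: starVar Θ X
var<:starVar Θ X (acc rec) =
  subst (Θ ⊢ var X <:_) (sym (starVar≡star-bound Θ X))
        (s-trans s-var (bound<:star (bound Θ X) refl))
  where
  bound<:star : ∀ B → bound Θ X ≡ B → Θ ⊢ B <: star Θ B
  bound<:star (var Y) eq = var<:starVar Θ Y (rec (bound≡var⇒< Θ X Y eq))
  bound<:star top        _ = s-refl
  bound<:star (_ ⇒ _)    _ = s-refl
  bound<:star (allK _ _) _ = s-refl
  bound<:star (allT _ _) _ = s-refl

<:star : ∀ {n} (Θ : Ctx n) T → Θ ⊢ T <: star Θ T
<:star Θ (var X)    = var<:starVar Θ X (>-wellFounded X)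
<:star Θ top        = s-refl
<:star Θ (_ ⇒ _)    = s-refl
<:star Θ (allK _ _) = s-refl
<:star Θ (allT _ _) = s-refl

star-mono : ∀ {n} {Θ : Ctx n} {S U} → Θ ⊢ S <: U → Θ ⊢ star Θ S <: star Θ U
star-mono {Θ = Θ} (s-var {X = X}) =
  subst (λ B → Θ ⊢ B <: star Θ (bound Θ X)) (sym (starVar≡star-bound Θ X)) s-refl
star-mono s-top          = s-top
star-mono s-refl         = s-refl
star-mono (s-trans d e)  = s-trans (star-mono d) (star-mono e)
star-mono (s-arr d e)    = s-arr d e
star-mono (s-allFun d)   = s-allFun d
star-mono (s-allLoc d e) = s-allLoc d e
star-mono (s-allTop d e) = s-allTop d e

mainTheorem12 : ∀ {n} (Θ : Ctx n) (T : Ty n) →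
    ¬ IsVar (star Θ T) × (Θ ⊢ T <: star Θ T) ×
    (∀ (T' : Ty n) → ¬ IsVar T' → Θ ⊢ T <: T' → Θ ⊢ star Θ T <: T')
mainTheorem12 Θ T = ¬IsVar-star Θ T , <:star Θ T , minimal
  where
  minimal : ∀ T' → ¬ IsVar T' → Θ ⊢ T <: T' → Θ ⊢ star Θ T <: T'
  minimal T' ¬var T<:T' =
    subst (Θ ⊢ star Θ T <:_) (star-¬IsVar Θ T' ¬var) (star-mono T<:T')
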